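{- Input-output conformance simulation (ioco-s) is a precongruence for each GSOS language in ioco-s format: for every n-ary operation f of such a language and all states p_1,...,p_n,q_1,...,q_n of an LTS with inputs and outputs, if p_i ioco-s q_i for each 1 ≤ i ≤ n, then f(p_1,...,p_n) ioco-s f(q_1,...,q_n).
   Context: An LTS with inputs and outputs is (S,I,O,→) with disjoint finite sets I (input actions a?, b?, ...) and O (output actions a!, b!, ..., including the quiescence action δ!), L = I ∪ O, transition relation → ⊆ S × L × S (image-finite), such that p -δ!-> p' iff p = p' and p has no transition labelled by any a! ∈ O∖{δ!}. ins(p) is the set of input actions p can initially perform. A relation R is an ioco-s-relation if for each (p,q) ∈ R: (1) ins(q) ⊆ ins(p); (2) for all a? ∈ ins(q), if p -a?-> p' then q -a?-> q' for some q' with (p',q') ∈ R; (3) for all a! ∈ O, if p -a!-> p' then q -a!-> q' for some q' with (p',q') ∈ R. ioco-s is the largest ioco-s-relation. A GSOS rule for an n-ary operation f has the form: premises {x_i -a_{ij}-> y_{ij} | 1≤i≤n, 1≤j≤m_i} ∪ {x_i -/b_{ik}-> | 1≤i≤n, 1≤k≤ℓ_i}, conclusion f(x_1,...,x_n) -a-> C[x,y], where all x_i, y_{ij} are distinct variables and C is a term over these variables. Its positive (resp. negative) trigger for x_i is {a_{ij}} (resp. {b_{ik}}). A GSOS language is a finite signature, finite label set and finite set of GSOS rules; it defines transitions on closed terms in the standard way. An operation f is in ioco-s format if its defining rules satisfy: (1) every rule whose conclusion is labelled by an input action has only output actions as labels of negative premises and only input actions as labels of positive premises; (2) for each input action a?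 and each pair of rules r = H/(f(x_1,...,x_n) -a?-> t) and r' = H'/(f(x_1,...,x_n) -a?-> t'), there is a rule r'' = H''/(f(x_1,...,x_n) -a?-> t') such that (a) for each i, the positive trigger for x_i in r'' is included in that in r; (b) for each i, the negative trigger for x_i in r'' is included in that in r; (c) if x_i -b?-> z is in H'' and z occurs in t', then x_i -b?-> z is also in H'; (3) every rule whose conclusion is labelled by an output action has only input actions as labels of negative premises and only output actions as labels of positive premises. A GSOS language is in ioco-s format if each of its operations is. -}

module Defs where

open import Data.Nat using (ℕ; zero; suc)
open import Data.Fin using (Fin; zero; suc)
open import Data.Vec using (Vec; []; _∷_; lookup)
open import Data.List using (List; map)
open import Data.List.Membership.Propositional using (_∈_)
open import Data.List.Relation.Unary.Unique.Propositional using (Unique)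
open import Data.Product using (Σ; _×_; _,_; proj₂)
open import Data.Sum using (_⊎_; inj₁; inj₂; [_,_])
open import Data.Empty using (⊥)
open import Relation.Nullary using (¬_)
open import Relation.Binary.PropositionalEquality using (_≡_; _≢_)

-- Actions.  Inputs are Fin nI, outputs are Fin nO (disjoint, finite);
-- the quiescence action δ! is a designated output.

data Label (nI nO : ℕ) : Set where
  inp : Fin nI → Label nI nO
  out : Fin nO → Label nI nO

IsInput : ∀ {nI nO} → Label nI nO → Set
IsInput {nI} b = Σ (Fin nI) λ a → b ≡ inp a

IsOutput : ∀ {nI nO} → Label nI nO → Set
IsOutput {nO = nO} b = Σ (Fin nO) λ a → b ≡ out a

module LTS {nI nO : ℕ} (S : Set) (_⟶⟨_⟩_ : S → Label nI nO → S → Set) where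

  IsIOLTS : (δ : Fin nO) → Set
  IsIOLTS δ = ∀ p p' →
      (p ⟶⟨ out δ ⟩ p' →
         (p ≡ p') × (∀ o → o ≢ δ → ∀ p'' → ¬ (p ⟶⟨ out o ⟩ p'')))
    × ((p ≡ p') × (∀ o → o ≢ δ → ∀ p'' → ¬ (p ⟶⟨ out o ⟩ p''))
         → p ⟶⟨ out δ ⟩ p')

  ins : S → Fin nI → Set
  ins p a = Σ S λ p' → p ⟶⟨ inp a ⟩ p'

  IsIocosRelation : (S → S → Set) → Set
  IsIocosRelation R = ∀ {p q} → R p q →
      (∀ a → ins q a → ins p a)
    × (∀ a → ins q a → ∀ p' → p ⟶⟨ inp a ⟩ p' →
         Σ S λ q' → (q ⟶⟨ inp a ⟩ q') × R p' q')
    × (∀ o p' → p ⟶⟨ out o ⟩ p' →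
         Σ S λ q' → (q ⟶⟨ out o ⟩ q') × R p' q')

  _iocos_ : S → S → Set₁
  p iocos q = Σ (S → S → Set) λ R → IsIocosRelation R × R p q

data Term {nF : ℕ} (ar : Fin nF → ℕ) (V : Set) : Set where
  var : V → Term ar V
  op  : (f : Fin nF) → Vec (Term ar V) (ar f) → Term ar V

data Occurs {nF : ℕ} {ar : Fin nF → ℕ} {V : Set} (v : V) : Term ar V → Set where
  here  : Occurs v (var v)
  there : ∀ {f ts} (i : Fin (ar f)) → Occurs v (lookup ts i) → Occurs v (op f ts)

mutual
  subst : ∀ {nF} {ar : Fin nF → ℕ} {V W : Set} →
          (V → Term ar W) → Term ar V → Term ar W
  subst ρ (var v)   = ρ v
  subst ρ (op f ts) = op f (substs ρ ts)

  substs : ∀ {nF} {ar : Fin nF → ℕ} {V W : Set} {k} →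
           (V → Term ar W) → Vec (Term ar V) k → Vec (Term ar W) k
  substs ρ []       = []
  substs ρ (t ∷ ts) = subst ρ t ∷ substs ρ ts

-- Source variables are x_i = inj₁ i (i : Fin n); target variables y are
-- named by natural numbers, y = inj₂ y.
--   pos : premises  x_i -a-> y   as triples (i , a , y)
--   neg : premises  x_i -/b->    as pairs   (i , b)
--   act : label of the conclusion,  tgt : the target C[x,y].

record Rule (nI nO nF : ℕ) (ar : Fin nF → ℕ) (n : ℕ) : Set where
  field
    pos    : List (Fin n × Label nI nO × ℕ)
    neg    : List (Fin n × Label nI nO)
    act    : Label nI nO
    tgt    : Term ar (Fin n ⊎ ℕ)
    unique : Unique (map (λ prem → proj₂ (proj₂ prem)) pos)
    scoped : ∀ y → Occurs (inj₂ y) tgt →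
             Σ (Fin n) λ i → Σ (Label nI nO) λ a → (i , a , y) ∈ pos

  PosTrig : Fin n → Label nI nO → Set
  PosTrig i a = Σ ℕ λ y → (i , a , y) ∈ pos

  NegTrig : Fin n → Label nI nO → Set
  NegTrig i b = (i , b) ∈ neg

open Rule public

record GSOSLang : Set where
  field
    nI nO : ℕ
    δ     : Fin nO
    nF    : ℕ
    ar    : Fin nF → ℕ
    rules : (f : Fin nF) → List (Rule nI nO nF ar (ar f))

module Semantics (L : GSOSLang) where
  open GSOSLang L

  Closed : Set
  Closed = Term ar ⊥

  Lab : Set
  Lab = Label nI nO

  RuleOf : Fin nF → Set
  RuleOf f = Rule nI nO nF ar (ar f)

  mutual
    _⟶⟨_⟩_ : Closed → Lab → Closed → Set
    var () ⟶⟨ a ⟩ t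
    op f ps ⟶⟨ a ⟩ t =
      Σ (RuleOf f) λ r → (r ∈ rules f) × (act r ≡ a) ×
      Σ (ℕ → Closed) λ σ →
          (∀ {i b y} → (i , b , y) ∈ pos r → stepAt ps i b (σ y))
        × (∀ {i b} → (i , b) ∈ neg r → ∀ p' → ¬ stepAt ps i b p')
        × (t ≡ subst [ (λ i → lookup ps i) , σ ] (tgt r))
    stepAt : ∀ {k} → Vec Closed k → Fin k → Lab → Closed → Set
    stepAt (p ∷ ps) zero    b p' = p ⟶⟨ b ⟩ p'
    stepAt (p ∷ ps) (suc i) b p' = stepAt ps i b p'

  open LTS Closed _⟶⟨_⟩_ public

  Format1 : Fin nF → Set
  Format1 f = ∀ {r} → r ∈ rules f → ∀ {a} → act r ≡ inp a →
      (∀ {i b} → (i , b) ∈ neg r → IsOutput b)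
    × (∀ {i b y} → (i , b , y) ∈ pos r → IsInput b)

  Format2 : Fin nF → Set
  Format2 f = ∀ (a : Fin nI) {r r'} → r ∈ rules f → r' ∈ rules f →
      act r ≡ inp a → act r' ≡ inp a →
      Σ (RuleOf f) λ r'' → (r'' ∈ rules f) × (act r'' ≡ inp a) × (tgt r'' ≡ tgt r')
        × (∀ i b → PosTrig r'' i b → PosTrig r i b)
        × (∀ i b → NegTrig r'' i b → NegTrig r i b)
        × (∀ i (b : Fin nI) z → (i , inp b , z) ∈ pos r'' →
              Occurs (inj₂ z) (tgt r') → (i , inp b , z) ∈ pos r')

  Format3 : Fin nF → Set
  Format3 f = ∀ {r} → r ∈ rules f → ∀ {a} → act r ≡ out a →
      (∀ {i b} → (i , b) ∈ neg r → IsInput b)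
    × (∀ {i b y} → (i , b , y) ∈ pos r → IsOutput b)

  InIocosFormat : Set
  InIocosFormat = ∀ f → Format1 f × Format2 f × Format3 f

-- Let Rᵢ witness pᵢ ioco-s qᵢ; the closure ≲ of ⋃ Rᵢ under the operations is an
-- ioco-s-relation, by induction on derivations of ≲.  An output step of f(p⃗) is answered
-- by f(q⃗) with the same rule (format clause 3), an input step with the rule r'' of
-- clause 2, and an input enabled in f(q⃗) is enabled in f(p⃗) by the same rule
-- (clause 1).  Premises carry over by the ioco-s clauses for the pairs (pᵢ, qᵢ): the
-- separation of input and output labels makes positive premises transfer in the
-- direction of the step and negative ones in the opposite one.  The targets are then
-- related because ≲ is closed under substitution.
module Submission where

open import Defs
open import Data.Nat using (ℕ)
import Data.Nat.Properties as ℕ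
open import Data.Fin using (Fin; zero; suc)
import Data.Fin.Properties as Fin
open import Data.Vec using (Vec; _∷_; lookup)
open import Data.List using (List; []; _∷_; map)
open import Data.List.Membership.Propositional using (_∈_)
open import Data.List.Membership.Propositional.Properties using (∈-map⁺)
import Data.List.Membership.DecPropositional as DecMembership
open import Data.List.Relation.Unary.Any using (here; there)
import Data.List.Relation.Unary.All as All
open import Data.List.Relation.Unary.AllPairs using (_∷_)
open import Data.List.Relation.Unary.Unique.Propositional using (Unique)
open import Data.Product using (Σ; _×_; _,_; proj₁; proj₂)
open import Data.Product.Properties using (≡-dec)
open import Data.Sum using (_⊎_; inj₁; inj₂; [_,_])
open import Data.Empty using (⊥-elim)
open import Relation.Nullary using (¬_; yes; no)
open import Relation.Nullary.Decidable using (map′)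
open import Relation.Binary.Definitions using (DecidableEquality)
open import Relation.Binary.PropositionalEquality using (_≡_; refl; sym; cong)
import Relation.Binary.PropositionalEquality as Eq

_≟-Label_ : ∀ {nI nO} → DecidableEquality (Label nI nO)
inp a ≟-Label inp b = map′ (cong inp) (λ { refl → refl }) (a Fin.≟ b)
inp a ≟-Label out b = no λ ()
out a ≟-Label inp b = no λ ()
out a ≟-Label out b = map′ (cong out) (λ { refl → refl }) (a Fin.≟ b)

module _ {A K B : Set} (_≟_ : DecidableEquality K) (key : A → K) {P : A → B → Set} where

  choose-unique : (d : K → B) (xs : List A) → Unique (map key xs) →
                  (∀ {x} → x ∈ xs → Σ B (P x)) →
                  Σ (K → B) λ σ → ∀ {x} → x ∈ xs → P x (σ (key x))
  choose-unique d [] _ _ = d , λ ()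
  choose-unique d (x ∷ xs) (fresh ∷ unique) w
    with choose-unique d xs unique (λ m → w (there m))
  ... | σ , σ-ok = σ' , σ'-ok
    where
    σ' : K → B
    σ' k with k ≟ key x
    ... | yes _ = proj₁ (w (here refl))
    ... | no _  = σ k

    σ'-ok : ∀ {x'} → x' ∈ x ∷ xs → P x' (σ' (key x'))
    σ'-ok (here refl) with key x ≟ key x
    ... | yes _ = proj₂ (w (here refl))
    ... | no ≢  = ⊥-elim (≢ refl)
    σ'-ok {x'} (there m) with key x' ≟ key x
    ... | yes ≡ = ⊥-elim (All.lookup fresh (∈-map⁺ key m) (sym ≡))
    ... | no _  = σ-ok m

module Precongruence (L : GSOSLang) where
  open GSOSLang L
  open Semantics L

  Relation : Set₁
  Relation = Closed → Closed → Set

  IocosStep : Relation → Relation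
  IocosStep R p q =
      (∀ a → ins q a → ins p a)
    × (∀ a → ins q a → ∀ p' → p ⟶⟨ inp a ⟩ p' →
         Σ Closed λ q' → (q ⟶⟨ inp a ⟩ q') × R p' q')
    × (∀ o p' → p ⟶⟨ out o ⟩ p' →
         Σ Closed λ q' → (q ⟶⟨ out o ⟩ q') × R p' q')

  IocosStep-mono : ∀ {R R'} → (∀ {p q} → R p q → R' p q) →
                   ∀ {p q} → IocosStep R p q → IocosStep R' p q
  IocosStep-mono R⊆R' (enabled , inputs , outputs) =
      enabled
    , (λ a en p' s → let q' , s' , r = inputs a en p' s in q' , s' , R⊆R' r)
    , (λ o p' s → let q' , s' , r = outputs o p' s in q' , s' , R⊆R' r)

  ⋃ : {J : Set} → (J → Relation) → Relation
  ⋃ {J} R p q = Σ J λ j → R j p q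

  ⋃-isIocos : {J : Set} {R : J → Relation} →
              (∀ j → IsIocosRelation (R j)) → IsIocosRelation (⋃ R)
  ⋃-isIocos isIocos (j , r) = IocosStep-mono (j ,_) (isIocos j r)

  Compatible : Relation → Set
  Compatible S = ∀ f {ps qs : Vec Closed (ar f)} →
                 (∀ i → S (lookup ps i) (lookup qs i)) → S (op f ps) (op f qs)

  module _ {S : Relation} (S-compatible : Compatible S) where
    mutual
      subst-compatible : {V : Set} (ρ ρ' : V → Closed) (C : Term ar V) →
                         (∀ v → Occurs v C → S (ρ v) (ρ' v)) →
                         S (subst ρ C) (subst ρ' C)
      subst-compatible ρ ρ' (var v)   ρSρ' = ρSρ' v here
      subst-compatible ρ ρ' (op f ts) ρSρ' =
        S-compatible f (substs-compatible ρ ρ' ts λ v i o → ρSρ' v (there i o))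

      substs-compatible : {V : Set} {k : ℕ} (ρ ρ' : V → Closed) (ts : Vec (Term ar V) k) →
                          (∀ v i → Occurs v (lookup ts i) → S (ρ v) (ρ' v)) →
                          ∀ i → S (lookup (substs ρ ts) i) (lookup (substs ρ' ts) i)
      substs-compatible ρ ρ' (t ∷ ts) ρSρ' zero    = subst-compatible ρ ρ' t (λ v → ρSρ' v zero)
      substs-compatible ρ ρ' (t ∷ ts) ρSρ' (suc i) =
        substs-compatible ρ ρ' ts (λ v i → ρSρ' v (suc i)) i

  stepAt⇒⟶ : ∀ {k} (ps : Vec Closed k) i {b p'} → stepAt ps i b p' → lookup ps i ⟶⟨ b ⟩ p'
  stepAt⇒⟶ (p ∷ ps) zero    s = s
  stepAt⇒⟶ (p ∷ ps) (suc i) s = stepAt⇒⟶ ps i s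

  ⟶⇒stepAt : ∀ {k} (ps : Vec Closed k) i {b p'} → lookup ps i ⟶⟨ b ⟩ p' → stepAt ps i b p'
  ⟶⇒stepAt (p ∷ ps) zero    s = s
  ⟶⇒stepAt (p ∷ ps) (suc i) s = ⟶⇒stepAt ps i s

  env : ∀ {k} → Vec Closed k → (ℕ → Closed) → Fin k ⊎ ℕ → Closed
  env ps σ = [ (λ i → lookup ps i) , σ ]

  module _ {f : Fin nF} where
    Premise : Set
    Premise = Fin (ar f) × Lab × ℕ

    target : Premise → ℕ
    target (_ , _ , y) = y

    _≟-Premise_ : DecidableEquality Premise
    _≟-Premise_ = ≡-dec Fin._≟_ (≡-dec _≟-Label_ ℕ._≟_)

    PosHolds : Vec Closed (ar f) → RuleOf f → (ℕ → Closed) → Set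
    PosHolds ps r σ = ∀ {i b y} → (i , b , y) ∈ pos r → stepAt ps i b (σ y)

    NegHolds : Vec Closed (ar f) → RuleOf f → Set
    NegHolds ps r = ∀ {i b} → (i , b) ∈ neg r → ∀ p' → ¬ stepAt ps i b p'

    fire : ∀ {r a} (ps : Vec Closed (ar f)) → r ∈ rules f → act r ≡ a → (σ : ℕ → Closed) →
           PosHolds ps r σ → NegHolds ps r → op f ps ⟶⟨ a ⟩ subst (env ps σ) (tgt r)
    fire ps r∈ act≡ σ posOk negOk = _ , r∈ , act≡ , σ , posOk , negOk , refl

    choose-targets : (r : RuleOf f) (d : ℕ → Closed) {P : Premise → Closed → Set} →
                     (∀ {x} → x ∈ pos r → Σ Closed (P x)) →
                     Σ (ℕ → Closed) λ σ → ∀ {x} → x ∈ pos r → P x (σ (target x))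
    choose-targets r d w = choose-unique ℕ._≟_ target d (pos r) (unique r) w

  module Transfer (fmt : InIocosFormat) {S : Relation} (S-compatible : Compatible S)
                  {f : Fin nF} {ps qs : Vec Closed (ar f)}
                  (args-S : ∀ i → S (lookup ps i) (lookup qs i))
                  (args-step : ∀ i → IocosStep S (lookup ps i) (lookup qs i)) where

    enabled : ∀ i a → ins (lookup qs i) a → ins (lookup ps i) a
    enabled i = proj₁ (args-step i)

    input-step : ∀ i a → ins (lookup qs i) a → ∀ p' → lookup ps i ⟶⟨ inp a ⟩ p' →
                 Σ Closed λ q' → (lookup qs i ⟶⟨ inp a ⟩ q') × S p' q'
    input-step i = proj₁ (proj₂ (args-step i))

    output-step : ∀ i o p' → lookup ps i ⟶⟨ out o ⟩ p' →
                  Σ Closed λ q' → (lookup qs i ⟶⟨ out o ⟩ q') × S p' q'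
    output-step i = proj₂ (proj₂ (args-step i))

    targets-S : ∀ {σ σ'} (C : Term ar (Fin (ar f) ⊎ ℕ)) →
                (∀ y → Occurs (inj₂ y) C → S (σ y) (σ' y)) →
                S (subst (env ps σ) C) (subst (env qs σ') C)
    targets-S {σ} {σ'} C σSσ' = subst-compatible {S = S} S-compatible (env ps σ) (env qs σ') C λ
      { (inj₁ i) _ → args-S i
      ; (inj₂ y) o → σSσ' y o }

    neg-inputs-transfer : ∀ r → (∀ {i b} → (i , b) ∈ neg r → IsInput b) →
                          NegHolds ps r → NegHolds qs r
    neg-inputs-transfer r inputs negP m q' s with inputs m
    ... | a , refl =
      let p' , s' = enabled _ a (q' , stepAt⇒⟶ qs _ s) in negP m p' (⟶⇒stepAt ps _ s')

    neg-outputs-transfer : ∀ r → (∀ {i b} → (i , b) ∈ neg r → IsOutput b) →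
                           NegHolds qs r → NegHolds ps r
    neg-outputs-transfer r outputs negQ m p' s with outputs m
    ... | o , refl =
      let q' , s' , _ = output-step _ o p' (stepAt⇒⟶ ps _ s) in negQ m q' (⟶⇒stepAt qs _ s')

    op-enabled : ∀ a → ins (op f qs) a → ins (op f ps) a
    op-enabled a (_ , r , r∈ , act≡ , σ , posQ , negQ , _) =
      _ , fire ps r∈ act≡ σ' σ'-ok (neg-outputs-transfer r neg-outs negQ)
      where
      neg-outs : ∀ {i b} → (i , b) ∈ neg r → IsOutput b
      neg-outs = proj₁ (proj₁ (fmt f) r∈ act≡)
      pos-ins : ∀ {i b y} → (i , b , y) ∈ pos r → IsInput b
      pos-ins = proj₂ (proj₁ (fmt f) r∈ act≡)
      Matched : Premise → Closed → Set
      Matched (i , b , _) p' = stepAt ps i b p'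
      step : ∀ {x} → x ∈ pos r → Σ Closed (Matched x)
      step {i , _ , y} m with pos-ins m
      ... | b , refl =
        let p' , s = enabled i b (σ y , stepAt⇒⟶ qs i (posQ m)) in p' , ⟶⇒stepAt ps i s
      σ' : ℕ → Closed
      σ' = proj₁ (choose-targets r σ step)
      σ'-ok : PosHolds ps r σ'
      σ'-ok = proj₂ (choose-targets r σ step)

    op-output : ∀ o p' → op f ps ⟶⟨ out o ⟩ p' →
                Σ Closed λ q' → (op f qs ⟶⟨ out o ⟩ q') × S p' q'
    op-output o _ (r , r∈ , act≡ , σ , posP , negP , refl) =
        _
      , fire qs r∈ act≡ σ' (λ m → proj₁ (σ'-ok m)) (neg-inputs-transfer r neg-ins negP)
      , targets-S (tgt r) λ y o → let _ , _ , m = scoped r y o in proj₂ (σ'-ok m)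
      where
      neg-ins : ∀ {i b} → (i , b) ∈ neg r → IsInput b
      neg-ins = proj₁ (proj₂ (proj₂ (fmt f)) r∈ act≡)
      pos-outs : ∀ {i b y} → (i , b , y) ∈ pos r → IsOutput b
      pos-outs = proj₂ (proj₂ (proj₂ (fmt f)) r∈ act≡)
      Matched : Premise → Closed → Set
      Matched (i , b , y) q' = stepAt qs i b q' × S (σ y) q'
      step : ∀ {x} → x ∈ pos r → Σ Closed (Matched x)
      step {i , _ , y} m with pos-outs m
      ... | b , refl =
        let q' , s , p'Sq' = output-step i b (σ y) (stepAt⇒⟶ ps i (posP m))
        in q' , ⟶⇒stepAt qs i s , p'Sq'
      σ' : ℕ → Closed
      σ' = proj₁ (choose-targets r σ step)
      σ'-ok : ∀ {x} → x ∈ pos r → Matched x (σ' (target x))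
      σ'-ok = proj₂ (choose-targets r σ step)

    -- f(q⃗) answers with the rule r'' that format clause (2) yields for the rule rq
    -- enabling a? in f(q⃗) and the rule rp fired by f(p⃗): the premises of r'' hold for
    -- q⃗ as they are among those of rq, and each of its target variables occurring in
    -- tgt rp is bound by a premise of rp, so it can be matched with the target of p⃗.
    op-input : ∀ a → ins (op f qs) a → ∀ p' → op f ps ⟶⟨ inp a ⟩ p' →
               Σ Closed λ q' → (op f qs ⟶⟨ inp a ⟩ q') × S p' q'
    op-input a (_ , rq , rq∈ , actq , σq , posQ , negQ , _) _ (rp , rp∈ , actp , σp , posP , _ , refl)
      with proj₁ (proj₂ (fmt f)) a rq∈ rp∈ actq actp
    ... | r'' , r''∈ , act'' , tgt≡ , pos⊆ , neg⊆ , bound-in-rp =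
        _
      , fire qs r''∈ act'' σ'' (λ m → proj₁ (σ''-ok m)) (λ m → negQ (neg⊆ _ _ m))
      , Eq.subst (λ C → S (subst (env ps σp) (tgt rp)) (subst (env qs σ'') C)) (sym tgt≡)
          (targets-S (tgt rp) matches-rp)
      where
      pos-ins : ∀ {i b z} → (i , b , z) ∈ pos r'' → IsInput b
      pos-ins = proj₂ (proj₁ (fmt f) r''∈ act'')
      Matched : Premise → Closed → Set
      Matched x@(i , b , z) q' = stepAt qs i b q' × (x ∈ pos rp → S (σp z) q')
      step : ∀ {x} → x ∈ pos r'' → Σ Closed (Matched x)
      step {i , _ , z} m with pos-ins m
      ... | b , refl with pos⊆ i (inp b) (z , m)
      ... | y , m-rq with DecMembership._∈?_ _≟-Premise_ (i , inp b , z) (pos rp)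
      ... | no ∉rp = σq y , posQ m-rq , λ ∈rp → ⊥-elim (∉rp ∈rp)
      ... | yes ∈rp =
        let q' , s , p'Sq' = input-step i b (σq y , stepAt⇒⟶ qs i (posQ m-rq))
                                         (σp z) (stepAt⇒⟶ ps i (posP ∈rp))
        in q' , ⟶⇒stepAt qs i s , λ _ → p'Sq'
      σ'' : ℕ → Closed
      σ'' = proj₁ (choose-targets r'' σq step)
      σ''-ok : ∀ {x} → x ∈ pos r'' → Matched x (σ'' (target x))
      σ''-ok = proj₂ (choose-targets r'' σq step)
      matches-rp : ∀ z → Occurs (inj₂ z) (tgt rp) → S (σp z) (σ'' z)
      matches-rp z o with scoped r'' z (Eq.subst (Occurs (inj₂ z)) (sym tgt≡) o)
      ... | i , _ , m with pos-ins m
      ... | b , refl = proj₂ (σ''-ok m) (bound-in-rp i b z m o)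

    op-step : IocosStep S (op f ps) (op f qs)
    op-step = op-enabled , op-input , op-output

  data Closure (R : Relation) : Relation where
    embed      : ∀ {p q} → R p q → Closure R p q
    congruence : ∀ f {ps qs : Vec Closed (ar f)} →
                 (∀ i → Closure R (lookup ps i) (lookup qs i)) →
                 Closure R (op f ps) (op f qs)

  Closure-isIocos : InIocosFormat → ∀ {R} → IsIocosRelation R → IsIocosRelation (Closure R)
  Closure-isIocos fmt isIocos (embed r) = IocosStep-mono embed (isIocos r)
  Closure-isIocos fmt isIocos (congruence f {ps} {qs} args) =
    Transfer.op-step fmt congruence {ps = ps} {qs = qs} args
      λ i → Closure-isIocos fmt isIocos (args i)

theorem5 : (L : GSOSLang) →
    Semantics.IsIOLTS L (GSOSLang.δ L) →
    Semantics.InIocosFormat L →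
    (f : Fin (GSOSLang.nF L)) →
    (ps qs : Vec (Semantics.Closed L) (GSOSLang.ar L f)) →
    (∀ i → Semantics._iocos_ L (lookup ps i) (lookup qs i)) →
    Semantics._iocos_ L (op f ps) (op f qs)
theorem5 L _ fmt f ps qs psᵢ-iocos-qsᵢ =
    Closure (⋃ R)
  , Closure-isIocos fmt (⋃-isIocos λ i → proj₁ (proj₂ (psᵢ-iocos-qsᵢ i)))
  , congruence f (λ i → embed (i , proj₂ (proj₂ (psᵢ-iocos-qsᵢ i))))
  where
  open Precongruence L
  R : Fin (GSOSLang.ar L f) → Relation
  R i = proj₁ (psᵢ-iocos-qsᵢ i)
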